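{- Let $n\ge 3$ and let $V$ be a set of words of length $n$ over the alphabet $\{0,1,*\}$ satisfying the following conditions: (1) for every $v\in V$, exactly $2$ of the letters $v_1,\dots,v_n$ belong to $\{0,1\}$; (2) if $u,v\in V$ are distinct, then there is exactly one index $i$ such that $\{v_i,u_i\}=\{0,1\}$; (3) if $u,v\in V$ are distinct, then $\{i: u_i\in\{0,1\}\}\neq\{i: v_i\in\{0,1\}\}$. Then $|V|\le 3$. -}

module Defs where

open import Data.Nat using (ℕ; zero; suc)
open import Data.Fin using (Fin; zero; suc)
open import Data.Bool using (Bool; true; false; if_then_else_)
open import Data.Vec using (Vec; lookup)

data Letter : Set where
  𝟎 𝟏 ⋆ : Letter

Word : ℕ → Set
Word n = Vec Letter n

isBit : Letter → Bool
isBit 𝟎 = true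
isBit 𝟏 = true
isBit ⋆ = false

complementary : Letter → Letter → Bool
complementary 𝟎 𝟏 = true
complementary 𝟏 𝟎 = true
complementary _ _ = false

countIdx : (n : ℕ) → (Fin n → Bool) → ℕ
countIdx zero p = zero
countIdx (suc n) p = (if p zero then 1 else 0) Data.Nat.+ countIdx n (λ i → p (suc i))

numBits : {n : ℕ} → Word n → ℕ
numBits {n} v = countIdx n (λ i → isBit (lookup v i))

numConflicts : {n : ℕ} → Word n → Word n → ℕ
numConflicts {n} u v = countIdx n (λ i → complementary (lookup u i) (lookup v i))

module Submission where

-- Read every word as a 0/1-valued pattern of positions and count
-- along positions.  First, for two distinct words u, v of V: each has two bit
-- positions, so bits(u) + bits(v) = 4 = 2·shared + differ, where "shared" counts
-- the positions where both carry a bit and "differ" those where exactly one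
-- does.  Condition (3) gives differ ≥ 1, and shared = conflicts + agreements
-- = 1 + agreements by condition (2); hence u and v agree at no position.
-- Second, at any single position, the words that conflict with a given word a
-- all carry the complement of a's bit there, so any two of them agree:
--   conflict(a,b) + conflict(a,c) + conflict(a,d)
--     ≤ bit(a) + agree(b,c) + agree(b,d) + agree(c,d),
-- a finite fact about four letters checked by evaluation.  Summing it over
-- all positions for four distinct words a, b, c, d of V gives 3 ≤ 2 + 0,
-- so V has no four distinct elements.

open import Defs
open import Data.Nat using (ℕ; zero; suc; _+_; _*_; _≤_; _≥_; z≤n; s≤s; _≤?_)
open import Data.Nat.Properties
  using (+-*-semiring; +-mono-≤; *-monoʳ-≤; m+n≡0⇒m≡0; m+n≡0⇒n≡0)
open import Algebra.Properties.Semiring.Sum +-*-semiring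
  using (sum; ∑-distrib-+; *-distribˡ-sum; sum-cong-≗)
open import Data.Fin using (Fin; zero; suc)
open import Data.Bool using (Bool; true; false; if_then_else_; _xor_)
open import Data.Empty using (⊥; ⊥-elim)
open import Data.List using (List; length; []; _∷_)
open import Data.List.Relation.Unary.Unique.Propositional using (Unique)
open import Data.List.Relation.Unary.AllPairs using (_∷_)
open import Data.List.Relation.Unary.All as All using (All; all?; _∷_)
open import Data.List.Membership.Propositional using (_∈_)
open import Data.List.Relation.Unary.Any using (here; there)
open import Data.Vec using (lookup)
open import Relation.Binary.PropositionalEquality
  using (_≡_; refl; sym; trans; cong; cong₂; subst; subst₂; module ≡-Reasoning)
open import Relation.Nullary using (¬_; Dec; contradiction)
open import Relation.Nullary.Decidable using (from-yes)

∑ : (n : ℕ) → (Fin n → ℕ) → ℕ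
∑ n f = sum {n} f

∑-distrib-+₃ : ∀ n (f g h : Fin n → ℕ) → ∑ n (λ i → f i + g i + h i) ≡ ∑ n f + ∑ n g + ∑ n h
∑-distrib-+₃ n f g h =
  trans (∑-distrib-+ {n} (λ i → f i + g i) h) (cong (_+ ∑ n h) (∑-distrib-+ {n} f g))

∑-mono-≤ : ∀ n {f g : Fin n → ℕ} → (∀ i → f i ≤ g i) → ∑ n f ≤ ∑ n g
∑-mono-≤ zero    f≤g = z≤n
∑-mono-≤ (suc n) f≤g = +-mono-≤ (f≤g zero) (∑-mono-≤ n (λ i → f≤g (suc i)))

∑≡0⇒≡0 : ∀ n (f : Fin n → ℕ) → ∑ n f ≡ 0 → ∀ i → f i ≡ 0
∑≡0⇒≡0 (suc n) f ∑f≡0 zero    = m+n≡0⇒m≡0 (f zero) ∑f≡0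
∑≡0⇒≡0 (suc n) f ∑f≡0 (suc i) = ∑≡0⇒≡0 n (λ j → f (suc j)) (m+n≡0⇒n≡0 (f zero) ∑f≡0) i

indicator : Bool → ℕ
indicator b = if b then 1 else 0

countIdx≡∑ : ∀ n (p : Fin n → Bool) → countIdx n p ≡ ∑ n (λ i → indicator (p i))
countIdx≡∑ zero    p = refl
countIdx≡∑ (suc n) p = cong (indicator (p zero) +_) (countIdx≡∑ n (λ i → p (suc i)))

bit : Letter → ℕ
bit a = indicator (isBit a)

conflict : Letter → Letter → ℕ
conflict a b = indicator (complementary a b)

agree : Letter → Letter → ℕ
agree 𝟎 𝟎 = 1
agree 𝟏 𝟏 = 1
agree _ _ = 0

shared : Letter → Letter → ℕ
shared a b = bit a * bit b

differ : Letter → Letter → ℕ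
differ a b = indicator (isBit a xor isBit b)

indicator-+ : ∀ p q → indicator p + indicator q ≡ 2 * (indicator p * indicator q) + indicator (p xor q)
indicator-+ false false = refl
indicator-+ false true  = refl
indicator-+ true  false = refl
indicator-+ true  true  = refl

xor≡false : ∀ p q → indicator (p xor q) ≡ 0 → p ≡ q
xor≡false false false _ = refl
xor≡false true  true  _ = refl

shared≡conflict+agree : ∀ a b → shared a b ≡ conflict a b + agree a b
shared≡conflict+agree 𝟎 𝟎 = refl
shared≡conflict+agree 𝟎 𝟏 = refl
shared≡conflict+agree 𝟎 ⋆ = refl
shared≡conflict+agree 𝟏 𝟎 = refl
shared≡conflict+agree 𝟏 𝟏 = refl
shared≡conflict+agree 𝟏 ⋆ = refl
shared≡conflict+agree ⋆ 𝟎 = refl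
shared≡conflict+agree ⋆ 𝟏 = refl
shared≡conflict+agree ⋆ ⋆ = refl

letters : List Letter
letters = 𝟎 ∷ 𝟏 ∷ ⋆ ∷ []

listed : ∀ a → a ∈ letters
listed 𝟎 = here refl
listed 𝟏 = there (here refl)
listed ⋆ = there (there (here refl))

-- At a single position: every letter conflicting with a is the complement of
-- a's bit, so any two such letters agree; at most one conflict comes for free.
Exclusion : Letter → Letter → Letter → Letter → Set
Exclusion a b c d =
  conflict a b + conflict a c + conflict a d ≤ bit a + (agree b c + agree b d + agree c d)

exclusion? : ∀ a b c d → Dec (Exclusion a b c d)
exclusion? a b c d = _ ≤? _

exclusion : ∀ a b c d → Exclusion a b c d
exclusion a b c d =
  All.lookup (All.lookup (All.lookup (All.lookup table (listed a)) (listed b)) (listed c)) (listed d)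
  where
  table : All (λ a → All (λ b → All (λ c → All (Exclusion a b c) letters) letters) letters) letters
  table = from-yes (all? (λ a → all? (λ b → all? (λ c → all? (exclusion? a b c) letters) letters) letters) letters)

agreements-vanish : ∀ A D → 4 ≡ 2 * (1 + A) + D → ¬ D ≡ 0 → A ≡ 0
agreements-vanish zero    D       _  _   = refl
agreements-vanish (suc A) zero    _  D≢0 = contradiction refl D≢0
agreements-vanish (suc A) (suc D) eq _   =
  contradiction (subst (5 ≤_) (sym eq) (+-mono-≤ (*-monoʳ-≤ 2 (s≤s (s≤s z≤n))) (s≤s z≤n))) 5≰4
  where
  5≰4 : ¬ 5 ≤ 4
  5≰4 (s≤s (s≤s (s≤s (s≤s ()))))

module _ {n : ℕ} where

  bitAt : Word n → Fin n → ℕ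
  bitAt u i = bit (lookup u i)

  at : (Letter → Letter → ℕ) → Word n → Word n → Fin n → ℕ
  at f u v i = f (lookup u i) (lookup v i)

  along : (Letter → Letter → ℕ) → Word n → Word n → ℕ
  along f u v = ∑ n (at f u v)

  numBits-∑ : ∀ u → numBits u ≡ 2 → ∑ n (bitAt u) ≡ 2
  numBits-∑ u = trans (sym (countIdx≡∑ n _))

  numConflicts-∑ : ∀ u v → numConflicts u v ≡ 1 → along conflict u v ≡ 1
  numConflicts-∑ u v = trans (sym (countIdx≡∑ n _))

  noAgreement : ∀ u v → numBits u ≡ 2 → numBits v ≡ 2 → numConflicts u v ≡ 1 →
    ¬ (∀ (i : Fin n) → isBit (lookup u i) ≡ isBit (lookup v i)) →
    along agree u v ≡ 0
  noAgreement u v bits-u bits-v conflicts-uv supports-differ =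
    agreements-vanish (along agree u v) (along differ u v) four≡ differ≢0
    where
    open ≡-Reasoning

    shared≡1+agree : along shared u v ≡ 1 + along agree u v
    shared≡1+agree = begin
      along shared u v                       ≡⟨ sum-cong-≗ (λ i → shared≡conflict+agree (lookup u i) (lookup v i)) ⟩
      ∑ n (λ i → at conflict u v i + at agree u v i)
                                             ≡⟨ ∑-distrib-+ {n} (at conflict u v) (at agree u v) ⟩
      along conflict u v + along agree u v   ≡⟨ cong (_+ along agree u v) (numConflicts-∑ u v conflicts-uv) ⟩
      1 + along agree u v                    ∎

    four≡ : 4 ≡ 2 * (1 + along agree u v) + along differ u v
    four≡ = begin
      2 + 2                                  ≡⟨ sym (cong₂ _+_ (numBits-∑ u bits-u) (numBits-∑ v bits-v)) ⟩
      ∑ n (bitAt u) + ∑ n (bitAt v)          ≡⟨ sym (∑-distrib-+ (bitAt u) (bitAt v)) ⟩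
      ∑ n (λ i → bitAt u i + bitAt v i)      ≡⟨ sum-cong-≗ (λ i → indicator-+ (isBit (lookup u i)) (isBit (lookup v i))) ⟩
      ∑ n (λ i → 2 * at shared u v i + at differ u v i)
                                             ≡⟨ ∑-distrib-+ {n} (λ i → 2 * at shared u v i) (at differ u v) ⟩
      ∑ n (λ i → 2 * at shared u v i) + along differ u v
                                             ≡⟨ cong (_+ along differ u v) (sym (*-distribˡ-sum {n} 2 (at shared u v))) ⟩
      2 * along shared u v + along differ u v
                                             ≡⟨ cong (λ s → 2 * s + along differ u v) shared≡1+agree ⟩
      2 * (1 + along agree u v) + along differ u v ∎

    differ≢0 : ¬ along differ u v ≡ 0
    differ≢0 differ≡0 = supports-differ λ i →
      xor≡false _ _ (∑≡0⇒≡0 n (at differ u v) differ≡0 i)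

  noFourWords : ∀ (a b c d : Word n) → numBits a ≡ 2 →
    numConflicts a b ≡ 1 → numConflicts a c ≡ 1 → numConflicts a d ≡ 1 →
    along agree b c ≡ 0 → along agree b d ≡ 0 → along agree c d ≡ 0 → ⊥
  noFourWords a b c d bits-a ab ac ad bc bd cd = 3≰2 (subst₂ _≤_ conflicts≡3 budget≡2 summed)
    where
    conflictsOf-a budget : Fin n → ℕ
    conflictsOf-a i = at conflict a b i + at conflict a c i + at conflict a d i
    budget i = bitAt a i + (at agree b c i + at agree b d i + at agree c d i)

    summed : ∑ n conflictsOf-a ≤ ∑ n budget
    summed = ∑-mono-≤ n (λ i → exclusion (lookup a i) (lookup b i) (lookup c i) (lookup d i))

    conflicts≡3 : ∑ n conflictsOf-a ≡ 3
    conflicts≡3 = trans (∑-distrib-+₃ n (at conflict a b) (at conflict a c) (at conflict a d))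
      (cong₂ _+_ (cong₂ _+_ (numConflicts-∑ a b ab) (numConflicts-∑ a c ac)) (numConflicts-∑ a d ad))

    budget≡2 : ∑ n budget ≡ 2
    budget≡2 = trans (∑-distrib-+ {n} (bitAt a) (λ i → at agree b c i + at agree b d i + at agree c d i))
      (cong₂ _+_ (numBits-∑ a bits-a)
        (trans (∑-distrib-+₃ n (at agree b c) (at agree b d) (at agree c d)) (cong₂ _+_ (cong₂ _+_ bc bd) cd)))

    3≰2 : ¬ 3 ≤ 2
    3≰2 (s≤s (s≤s ()))

mainTheorem2 : (n : ℕ) → n ≥ 3 → (V : List (Word n)) → Unique V →
    (∀ v → v ∈ V → numBits v ≡ 2) →
    (∀ u v → u ∈ V → v ∈ V → ¬ u ≡ v → numConflicts u v ≡ 1) →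
    (∀ u v → u ∈ V → v ∈ V → ¬ u ≡ v →
    ¬ (∀ (i : Fin n) → isBit (lookup u i) ≡ isBit (lookup v i))) →
    length V ≤ 3
mainTheorem2 n _ []                _ _ _ _ = z≤n
mainTheorem2 n _ (_ ∷ [])          _ _ _ _ = s≤s z≤n
mainTheorem2 n _ (_ ∷ _ ∷ [])      _ _ _ _ = s≤s (s≤s z≤n)
mainTheorem2 n _ (_ ∷ _ ∷ _ ∷ [])  _ _ _ _ = s≤s (s≤s (s≤s z≤n))
mainTheorem2 n _ V@(a ∷ b ∷ c ∷ d ∷ _)
  ((a≢b ∷ a≢c ∷ a≢d ∷ _) ∷ (b≢c ∷ b≢d ∷ _) ∷ (c≢d ∷ _) ∷ _) bits conflicts supports =
  ⊥-elim (noFourWords a b c d (bits a a∈V)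
    (conflicts a b a∈V b∈V a≢b) (conflicts a c a∈V c∈V a≢c) (conflicts a d a∈V d∈V a≢d)
    (agreeNowhere b c b∈V c∈V b≢c) (agreeNowhere b d b∈V d∈V b≢d) (agreeNowhere c d c∈V d∈V c≢d))
  where
  a∈V : a ∈ V
  a∈V = here refl
  b∈V : b ∈ V
  b∈V = there (here refl)
  c∈V : c ∈ V
  c∈V = there (there (here refl))
  d∈V : d ∈ V
  d∈V = there (there (there (here refl)))

  agreeNowhere : ∀ u v → u ∈ V → v ∈ V → ¬ u ≡ v → along agree u v ≡ 0
  agreeNowhere u v u∈V v∈V u≢v =
    noAgreement u v (bits u u∈V) (bits v v∈V) (conflicts u v u∈V v∈V u≢v) (supports u v u∈V v∈V u≢v)
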